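{- Let $\mathcal{S}$ be a degree sequence and let $\phi=v_1,\ldots,v_n$ be a realizing topological ordering for $\mathcal{S}$ (with realizing dag $D$). If there are indices $1\le i<j\le n$ with $p^\phi_i=p^\phi_j$, then $\phi'=\phi[1,i]\phi[j+1,n]$ is a realizing topological ordering for the degree sequence obtained from $\mathcal{S}$ by deleting the degree pairs of the vertices in $\phi[i+1,j]$; that is, there is a dag $D'$ on the vertices of $\phi'$, each vertex having the same in- and outdegree as in $D$, of which $\phi'$ is a topological ordering. Moreover, $D'$ can be chosen such that its potential $p^{\phi'}_{i+l}$ equals $p^\phi_{j+l}$ for all $1\le l\le n-j$.
   Context: A degree sequence is a multiset of pairs $\binom{a}{b}$ of nonnegative integers ($a$ indegree, $b$ outdegree), all at most a fixed positive integer $\Delta$. A dag (directed acyclic graph without parallel arcs and self-loops) realizes it if its vertices are in bijection with the elements such that each vertex has the in/outdegree of its element. A topological ordering of a dag is an ordering of all vertices such that all arcs go from earlier to later vertices; a realizing topological ordering for $\mathcal{S}$ is a topological ordering of a dag realizing $\mathcal{S}$ (the dag being fixed with it). $\phi[i,j]$ denotes $v_i,\ldots,v_j$, and juxtaposition denotes concatenation. For a dag with topological ordering $v_1,\ldots,v_n$ and $0\le i\le n$, the potential $p_i\in\mathbb{N}^\Delta$ is given by $p_i[l]$ = number of vertices among $v_1,\ldots,v_i$ having at least $l$ neighbors among $v_{i+1},\ldots,v_n$. -}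

module Defs where

open import Data.Nat using (ℕ; zero; suc; _+_; _∸_; _≤ᵇ_; _<ᵇ_; _<_)
open import Data.Bool using (Bool; true; false; _∧_; _∨_; if_then_else_)
open import Data.Fin using (Fin; toℕ) renaming (zero to fzero; suc to fsuc)
open import Data.Vec using (Vec; tabulate)
open import Relation.Binary.PropositionalEquality using (_≡_)

-- A dag on the vertex set Fin n whose (fixed) topological ordering is
-- v₁ = 0, v₂ = 1, …, vₙ = n-1.  'arc a b ≡ true' means there is an arc a → b.
-- Boolean adjacency: no parallel arcs; arcs only go forward: no loops, acyclic,
-- and the identity ordering is a topological ordering.
record Dag (n : ℕ) : Set where
  field
    arc : Fin n → Fin n → Bool
    forward : ∀ a b → arc a b ≡ true → toℕ a < toℕ b
open Dag public

b2n : Bool → ℕ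
b2n true = 1
b2n false = 0

sumF : ∀ {n} → (Fin n → ℕ) → ℕ
sumF {zero} f = 0
sumF {suc n} f = f fzero + sumF (λ k → f (fsuc k))

indeg : ∀ {n} → Dag n → Fin n → ℕ
indeg D v = sumF (λ u → b2n (arc D u v))

outdeg : ∀ {n} → Dag n → Fin n → ℕ
outdeg D v = sumF (λ w → b2n (arc D v w))

-- number of neighbours of v among v_{i+1}, …, v_n (0-based positions ≥ i)
nbAfter : ∀ {n} → Dag n → ℕ → Fin n → ℕ
nbAfter D i v = sumF (λ w → b2n ((i ≤ᵇ toℕ w) ∧ (arc D v w ∨ arc D w v)))

-- potential p_i ∈ ℕ^Δ : entry l (1 ≤ l ≤ Δ, stored at index l-1) counts the
-- vertices among v₁,…,v_i having at least l neighbours among v_{i+1},…,v_n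
potential : ∀ {n} → (Δ : ℕ) → Dag n → ℕ → Vec ℕ Δ
potential Δ D i =
  tabulate (λ l → sumF (λ v → b2n ((toℕ v <ᵇ i) ∧ (suc (toℕ l) ≤ᵇ nbAfter D i v))))

-- 0-based position in φ' = φ[1,i] φ[j+1,n] ↦ 0-based position in φ
shift : ℕ → ℕ → ℕ → ℕ
shift i j k = if k <ᵇ i then k else k + (j ∸ i)

-- For a vertex x before the cut k (one of the first k vertices), let c_k(x) be the number of its
-- arcs to vertices after the cut.  Entry l of the potential p_k counts the x < k with c_k(x) ≥ l,
-- and c_k(x) ≤ Δ, so p_i = p_j says that the multiset {c_i(x) | x < i}, padded with j - i zeros,
-- equals {c_j(x) | x < j}.  Take a permutation π of the first j vertices realising this.  Each
-- x < i gives up its arcs beyond i and takes over the arcs that π(x) sends beyond j; the vertices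
-- π(x) with i ≤ x < j send no arcs beyond j.  Deleting φ[i+1, j] and moving vertex j + t to i + t
-- therefore preserves every degree, and everything after the cut j is copied unchanged, which
-- gives the potentials.
module Submission where

open import Defs
open import Data.Nat using (ℕ; zero; suc; _+_; _∸_; _≤_; _<_; _≤ᵇ_; _<ᵇ_; z≤n; s≤s; z<s; s<s; s<s⁻¹; _<?_; _≤?_; _≟_)
open import Data.Nat.Properties
open import Data.Bool using (Bool; true; false; _∧_; _∨_; if_then_else_; T)
open import Data.Bool.Properties using (T-≡; ∨-identityʳ)
open import Data.Unit using (tt)
open import Data.Fin using (Fin; toℕ; fromℕ<; punchIn) renaming (zero to fzero; suc to fsuc)
open import Data.Fin.Properties using (toℕ<n; fromℕ<-toℕ; toℕ-fromℕ<; any?)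
open import Data.Fin.Permutation using (Permutation′; _⟨$⟩ʳ_; insert)
import Data.Fin.Permutation as Permutation
open import Algebra.Properties.CommutativeMonoid.Sum +-0-commutativeMonoid using (sum; sum-remove; ∑-permute)
open import Data.Vec using (lookup; tabulate)
open import Data.Vec.Properties using (lookup∘tabulate; tabulate-cong)
open import Data.Product using (Σ; _×_; _,_; proj₁; proj₂)
open import Function using (_∘_; Equivalence)
open import Relation.Binary.PropositionalEquality
open import Relation.Nullary using (¬_; yes; no; contradiction)

≡true : ∀ {b} → T b → b ≡ true
≡true = Equivalence.to T-≡

≡false : ∀ {b} → ¬ T b → b ≡ false
≡false {false} _  = refl
≡false {true}  ¬t = contradiction tt ¬t

≤ᵇ-true : ∀ {m n} → m ≤ n → (m ≤ᵇ n) ≡ true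
≤ᵇ-true = ≡true ∘ ≤⇒≤ᵇ

≤ᵇ-false : ∀ {m n} → n < m → (m ≤ᵇ n) ≡ false
≤ᵇ-false {m} {n} n<m = ≡false (<⇒≱ n<m ∘ ≤ᵇ⇒≤ m n)

<ᵇ-true : ∀ {m n} → m < n → (m <ᵇ n) ≡ true
<ᵇ-true = ≡true ∘ <⇒<ᵇ

<ᵇ-false : ∀ {m n} → n ≤ m → (m <ᵇ n) ≡ false
<ᵇ-false {m} {n} n≤m = ≡false (≤⇒≯ n≤m ∘ <ᵇ⇒< m n)

+-cancelˡ-<ᵇ : ∀ a m n → (a + m <ᵇ a + n) ≡ (m <ᵇ n)
+-cancelˡ-<ᵇ zero    m n = refl
+-cancelˡ-<ᵇ (suc a) m n = +-cancelˡ-<ᵇ a m n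

+-cancelˡ-≤ᵇ : ∀ a m n → (a + m ≤ᵇ a + n) ≡ (m ≤ᵇ n)
+-cancelˡ-≤ᵇ a zero    n = ≤ᵇ-true (+-monoʳ-≤ a z≤n)
+-cancelˡ-≤ᵇ a (suc m) n rewrite +-suc a m = +-cancelˡ-<ᵇ a m n

sumF-cong : ∀ {n} {f g : Fin n → ℕ} → (∀ u → f u ≡ g u) → sumF f ≡ sumF g
sumF-cong {zero}  f≗g = refl
sumF-cong {suc n} f≗g = cong₂ _+_ (f≗g fzero) (sumF-cong (f≗g ∘ fsuc))

sumF-mono : ∀ {n} {f g : Fin n → ℕ} → (∀ u → f u ≤ g u) → sumF f ≤ sumF g
sumF-mono {zero}  f≤g = z≤n
sumF-mono {suc n} f≤g = +-mono-≤ (f≤g fzero) (sumF-mono (f≤g ∘ fsuc))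

sumF≡sum : ∀ {n} (f : Fin n → ℕ) → sumF f ≡ sum f
sumF≡sum {zero}  f = refl
sumF≡sum {suc n} f = cong (f fzero +_) (sumF≡sum (f ∘ fsuc))

sumF-permute : ∀ {n} (f : Fin n → ℕ) (π : Permutation′ n) → sumF f ≡ sumF (f ∘ (π ⟨$⟩ʳ_))
sumF-permute f π = trans (sumF≡sum f) (trans (∑-permute f π) (sym (sumF≡sum (f ∘ (π ⟨$⟩ʳ_)))))

sumF-remove : ∀ {n} (f : Fin (suc n) → ℕ) x → sumF f ≡ f x + sumF (f ∘ punchIn x)
sumF-remove f x =
  trans (sumF≡sum f) (trans (sum-remove {i = x} f) (cong (f x +_) (sym (sumF≡sum (f ∘ punchIn x)))))

sumBelow : ℕ → (ℕ → ℕ) → ℕ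
sumBelow zero    g = 0
sumBelow (suc n) g = g 0 + sumBelow n (g ∘ suc)

sumF≗sumBelow : ∀ {n} {f : Fin n → ℕ} {g : ℕ → ℕ} → (∀ v → f v ≡ g (toℕ v)) → sumF f ≡ sumBelow n g
sumF≗sumBelow {zero}  f≗g = refl
sumF≗sumBelow {suc n} f≗g = cong₂ _+_ (f≗g fzero) (sumF≗sumBelow (f≗g ∘ fsuc))

sumBelow-cong : ∀ n {g h} → (∀ k → k < n → g k ≡ h k) → sumBelow n g ≡ sumBelow n h
sumBelow-cong zero    g≗h = refl
sumBelow-cong (suc n) g≗h = cong₂ _+_ (g≗h 0 z<s) (sumBelow-cong n (λ k k<n → g≗h (suc k) (s<s k<n)))

sumBelow-zero : ∀ n {g} → (∀ k → k < n → g k ≡ 0) → sumBelow n g ≡ 0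
sumBelow-zero zero    g≗0 = refl
sumBelow-zero (suc n) g≗0 = cong₂ _+_ (g≗0 0 z<s) (sumBelow-zero n (λ k k<n → g≗0 (suc k) (s<s k<n)))

sumBelow-mono : ∀ n {g h} → (∀ k → k < n → g k ≤ h k) → sumBelow n g ≤ sumBelow n h
sumBelow-mono zero    g≤h = z≤n
sumBelow-mono (suc n) g≤h = +-mono-≤ (g≤h 0 z<s) (sumBelow-mono n (λ k k<n → g≤h (suc k) (s<s k<n)))

≤-sumBelow : ∀ {n} g {k} → k < n → g k ≤ sumBelow n g
≤-sumBelow {suc n} g {zero}  _   = m≤m+n (g 0) _
≤-sumBelow {suc n} g {suc k} k<n = ≤-trans (≤-sumBelow (g ∘ suc) (s<s⁻¹ k<n)) (m≤n+m _ (g 0))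

sumBelow-+ : ∀ a b g → sumBelow (a + b) g ≡ sumBelow a g + sumBelow b (λ t → g (a + t))
sumBelow-+ zero    b g = refl
sumBelow-+ (suc a) b g = trans (cong (g 0 +_) (sumBelow-+ a b (g ∘ suc))) (sym (+-assoc (g 0) _ _))

sumBelow-split : ∀ {k n} g → k ≤ n → sumBelow n g ≡ sumBelow k g + sumBelow (n ∸ k) (λ t → g (k + t))
sumBelow-split {k} {n} g k≤n = trans (cong (λ z → sumBelow z g) (sym (m+[n∸m]≡n k≤n))) (sumBelow-+ k (n ∸ k) g)

+-<-∸ : ∀ {k n t} → k ≤ n → t < n ∸ k → k + t < n
+-<-∸ {k} k≤n t<n∸k = subst (k + _ <_) (m+[n∸m]≡n k≤n) (+-monoʳ-< k t<n∸k)

sumBelow-trailing-zeros : ∀ {k n g} → k ≤ n → (∀ t → k + t < n → g (k + t) ≡ 0) → sumBelow n g ≡ sumBelow k g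
sumBelow-trailing-zeros {k} {n} {g} k≤n zeros = begin
  sumBelow n g                                        ≡⟨ sumBelow-split g k≤n ⟩
  sumBelow k g + sumBelow (n ∸ k) (λ t → g (k + t))   ≡⟨ cong (sumBelow k g +_) (sumBelow-zero (n ∸ k) zeros′) ⟩
  sumBelow k g + 0                                    ≡⟨ +-identityʳ _ ⟩
  sumBelow k g                                        ∎
  where
  open ≡-Reasoning
  zeros′ : ∀ t → t < n ∸ k → g (k + t) ≡ 0
  zeros′ t t<n∸k = zeros t (+-<-∸ k≤n t<n∸k)

sumBelow-splice : ∀ {i j n} g h → j ≤ n → sumBelow i g ≡ sumBelow j h
  → (∀ t → t < n ∸ j → g (i + t) ≡ h (j + t)) → sumBelow (i + (n ∸ j)) g ≡ sumBelow n h
sumBelow-splice {i} {j} {n} g h j≤n heads tails = begin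
  sumBelow (i + (n ∸ j)) g                            ≡⟨ sumBelow-+ i (n ∸ j) g ⟩
  sumBelow i g + sumBelow (n ∸ j) (λ t → g (i + t))   ≡⟨ cong₂ _+_ heads (sumBelow-cong (n ∸ j) tails) ⟩
  sumBelow j h + sumBelow (n ∸ j) (λ t → h (j + t))   ≡⟨ sym (sumBelow-split h j≤n) ⟩
  sumBelow n h                                        ∎
  where open ≡-Reasoning

atLeast : ∀ {m} → (Fin m → ℕ) → ℕ → ℕ
atLeast h l = sumF (λ u → b2n (l ≤ᵇ h u))

atLeast-beyond : ∀ {m} (h : Fin m → ℕ) {l} → (∀ u → h u ≤ l) → atLeast h (suc l) ≡ 0
atLeast-beyond {zero}  h h≤l = refl
atLeast-beyond {suc m} h h≤l rewrite ≤ᵇ-false (s≤s (h≤l fzero)) = atLeast-beyond (h ∘ fsuc) (h≤l ∘ fsuc)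

b2n-≤ᵇ-suc : ∀ c a → b2n (suc c ≤ᵇ a) ≤ b2n (c ≤ᵇ a)
b2n-≤ᵇ-suc c a with suc c ≤ᵇ a in eq
... | false = z≤n
... | true rewrite ≤ᵇ-true (<⇒≤ (≤ᵇ⇒≤ (suc c) a (subst T (sym eq) tt))) = ≤-refl

≤ᵇ-suc-≢ : ∀ {c a} → a ≢ c → (c ≤ᵇ a) ≡ (suc c ≤ᵇ a)
≤ᵇ-suc-≢ {c} {a} a≢c with c ≤? a
... | yes c≤a = trans (≤ᵇ-true c≤a) (sym (≤ᵇ-true (≤∧≢⇒< c≤a (a≢c ∘ sym))))
... | no  c≰a = trans (≤ᵇ-false (≰⇒> c≰a)) (sym (≤ᵇ-false (m<n⇒m<1+n (≰⇒> c≰a))))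

equal-atLeast⇒permutation : ∀ {m} (h₁ h₂ : Fin m → ℕ) → (∀ l → atLeast h₁ l ≡ atLeast h₂ l)
  → Σ (Permutation′ m) λ π → ∀ u → h₂ (π ⟨$⟩ʳ u) ≡ h₁ u
equal-atLeast⇒permutation {zero} h₁ h₂ same = Permutation.id , λ ()
equal-atLeast⇒permutation {suc m} h₁ h₂ same with any? (λ x → h₂ x ≟ h₁ fzero)
... | yes (x , h₂x≡c) = insert fzero x (proj₁ rest) , matched
  where
  h₂′ : Fin m → ℕ
  h₂′ = h₂ ∘ punchIn x
  same′ : ∀ l → atLeast (h₁ ∘ fsuc) l ≡ atLeast h₂′ l
  same′ l = +-cancelˡ-≡ (b2n (l ≤ᵇ h₁ fzero)) _ _ (begin
    atLeast h₁ l                                 ≡⟨ same l ⟩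
    atLeast h₂ l                                 ≡⟨ sumF-remove (λ u → b2n (l ≤ᵇ h₂ u)) x ⟩
    b2n (l ≤ᵇ h₂ x) + atLeast h₂′ l              ≡⟨ cong (λ z → b2n (l ≤ᵇ z) + atLeast h₂′ l) h₂x≡c ⟩
    b2n (l ≤ᵇ h₁ fzero) + atLeast h₂′ l          ∎)
    where open ≡-Reasoning
  rest : Σ (Permutation′ m) λ π → ∀ u → h₂′ (π ⟨$⟩ʳ u) ≡ h₁ (fsuc u)
  rest = equal-atLeast⇒permutation (h₁ ∘ fsuc) h₂′ same′
  matched : ∀ u → h₂ (insert fzero x (proj₁ rest) ⟨$⟩ʳ u) ≡ h₁ u
  matched fzero    = h₂x≡c
  matched (fsuc u) = proj₂ rest u
... | no c∉h₂ = contradiction (subst₂ _<_ (same (suc c)) (same c) drop₁) (<-irrefl (sym flat₂))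
  where
  c : ℕ
  c = h₁ fzero
  -- c is attained by h₁ but not by h₂: raising the threshold past c lowers one count but not the other.
  flat₂ : atLeast h₂ c ≡ atLeast h₂ (suc c)
  flat₂ = sumF-cong (λ u → cong b2n (≤ᵇ-suc-≢ (λ h₂u≡c → c∉h₂ (u , h₂u≡c))))
  drop₁ : atLeast h₁ (suc c) < atLeast h₁ c
  drop₁ rewrite ≤ᵇ-true (≤-refl {c}) | ≤ᵇ-false (n<1+n c) = s≤s (sumF-mono (λ u → b2n-≤ᵇ-suc c (h₁ (fsuc u))))

Adj : Set
Adj = ℕ → ℕ → Bool

Forward : Adj → Set
Forward A = ∀ x y → A x y ≡ true → x < y

linked : Adj → ℕ → ℕ → Bool
linked A x y = A x y ∨ A y x

module _ (N : ℕ) (A : Adj) where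

  outBelow inBelow : ℕ → ℕ
  outBelow x = sumBelow N (λ y → b2n (A x y))
  inBelow  y = sumBelow N (λ x → b2n (A x y))

  nbFrom : ℕ → ℕ → ℕ
  nbFrom k x = sumBelow N (λ y → b2n ((k ≤ᵇ y) ∧ linked A x y))

  crossing : ℕ → ℕ → ℕ
  crossing k x = if x <ᵇ k then nbFrom k x else 0

  -- entry l of the potential p_k (0-based, i.e. the paper's p_k[l + 1])
  potBelow : ℕ → ℕ → ℕ
  potBelow k l = sumBelow N (λ x → b2n (suc l ≤ᵇ crossing k x))

sumBelow-before-cut : ∀ {k K} (X : ℕ → Bool) → k ≤ K → sumBelow k (λ y → b2n ((K ≤ᵇ y) ∧ X y)) ≡ 0
sumBelow-before-cut X k≤K = sumBelow-zero _ (λ y y<k → cong (λ b → b2n (b ∧ X y)) (≤ᵇ-false (<-≤-trans y<k k≤K)))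

module Cuts {N : ℕ} {A : Adj} where

  crossing-< : ∀ {k x} → x < k → crossing N A k x ≡ nbFrom N A k x
  crossing-< x<k rewrite <ᵇ-true x<k = refl

  crossing-≥ : ∀ {k x} → k ≤ x → crossing N A k x ≡ 0
  crossing-≥ k≤x rewrite <ᵇ-false k≤x = refl

  crossing≤nbFrom : ∀ k x → crossing N A k x ≤ nbFrom N A k x
  crossing≤nbFrom k x with x <ᵇ k
  ... | true  = ≤-refl
  ... | false = z≤n

  arc≤nbFrom : ∀ {k y} z → k ≤ y → y < N → b2n (A z y) ≤ nbFrom N A k z
  arc≤nbFrom {k} {y} z k≤y y<N = ≤-trans arc≤term (≤-sumBelow (λ y → b2n ((k ≤ᵇ y) ∧ linked A z y)) y<N)
    where
    arc≤term : b2n (A z y) ≤ b2n ((k ≤ᵇ y) ∧ linked A z y)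
    arc≤term rewrite ≤ᵇ-true k≤y with A z y
    ... | true  = ≤-refl
    ... | false = z≤n

  nbFrom-anti : ∀ {k k′} z → k ≤ k′ → nbFrom N A k′ z ≤ nbFrom N A k z
  nbFrom-anti {k} {k′} z k≤k′ = sumBelow-mono N term
    where
    term : ∀ y → y < N → b2n ((k′ ≤ᵇ y) ∧ linked A z y) ≤ b2n ((k ≤ᵇ y) ∧ linked A z y)
    term y _ with k′ ≤? y
    ... | no  k′≰y rewrite ≤ᵇ-false (≰⇒> k′≰y) = z≤n
    ... | yes k′≤y rewrite ≤ᵇ-true k′≤y | ≤ᵇ-true (≤-trans k≤k′ k′≤y) = ≤-refl

  atLeast-crossing : ∀ {k j} l → k ≤ j → j ≤ N
    → atLeast (λ (u : Fin j) → crossing N A k (toℕ u)) (suc l) ≡ potBelow N A k l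
  atLeast-crossing {k} {j} l k≤j j≤N =
    trans (sumF≗sumBelow {j} {g = λ x → b2n (suc l ≤ᵇ crossing N A k x)} (λ _ → refl))
    (sym (sumBelow-trailing-zeros j≤N (λ t _ →
      cong (λ c → b2n (suc l ≤ᵇ c)) (crossing-≥ (≤-trans k≤j (m≤m+n _ t))))))

  module _ (fwd : Forward A) where

    forward-false : ∀ {x y} → y ≤ x → A x y ≡ false
    forward-false {x} {y} y≤x with A x y in eq
    ... | true  = contradiction (fwd x y eq) (≤⇒≯ y≤x)
    ... | false = refl

    nbFrom-tail : ∀ {k x} → x < k → k ≤ N → nbFrom N A k x ≡ sumBelow (N ∸ k) (λ t → b2n (A x (k + t)))
    nbFrom-tail {k} {x} x<k k≤N = trans (sumBelow-split (λ y → b2n ((k ≤ᵇ y) ∧ linked A x y)) k≤N)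
      (cong₂ _+_ (sumBelow-before-cut {k} (linked A x) ≤-refl) (sumBelow-cong (N ∸ k) tail))
      where
      tail : ∀ t → t < N ∸ k → b2n ((k ≤ᵇ k + t) ∧ linked A x (k + t)) ≡ b2n (A x (k + t))
      tail t _ rewrite ≤ᵇ-true (m≤m+n k t) | forward-false (≤-trans (<⇒≤ x<k) (m≤m+n k t)) = cong b2n (∨-identityʳ _)

    outBelow-split : ∀ {k x} → x < k → k ≤ N → outBelow N A x ≡ sumBelow k (λ y → b2n (A x y)) + nbFrom N A k x
    outBelow-split {x = x} x<k k≤N =
      trans (sumBelow-split (λ y → b2n (A x y)) k≤N) (cong (_ +_) (sym (nbFrom-tail x<k k≤N)))

    crossing≤outBelow : ∀ k x → crossing N A k x ≤ outBelow N A x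
    crossing≤outBelow k x with x <? k
    ... | no  x≮k rewrite crossing-≥ {k} (≮⇒≥ x≮k) = z≤n
    ... | yes x<k rewrite crossing-< {k} x<k = sumBelow-mono N term
      where
      term : ∀ y → y < N → b2n ((k ≤ᵇ y) ∧ linked A x y) ≤ b2n (A x y)
      term y _ with k ≤? y
      ... | no  k≰y rewrite ≤ᵇ-false (≰⇒> k≰y) = z≤n
      ... | yes k≤y rewrite ≤ᵇ-true k≤y | forward-false (≤-trans (<⇒≤ x<k) k≤y) | ∨-identityʳ (A x y) = ≤-refl

record Represents {n} (D : Dag n) (A : Adj) : Set where
  constructor represents
  field arc-≡ : ∀ a b → arc D a b ≡ A (toℕ a) (toℕ b)
open Represents

module _ {n} {D : Dag n} {A : Adj} (D≈A : Represents D A) where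

  indeg-represented : ∀ v → indeg D v ≡ inBelow n A (toℕ v)
  indeg-represented v = sumF≗sumBelow (λ u → cong b2n (arc-≡ D≈A u v))

  outdeg-represented : ∀ v → outdeg D v ≡ outBelow n A (toℕ v)
  outdeg-represented v = sumF≗sumBelow (λ w → cong b2n (arc-≡ D≈A v w))

  nbAfter-represented : ∀ k v → nbAfter D k v ≡ nbFrom n A k (toℕ v)
  nbAfter-represented k v =
    sumF≗sumBelow (λ w → cong (λ b → b2n ((k ≤ᵇ toℕ w) ∧ b)) (cong₂ _∨_ (arc-≡ D≈A v w) (arc-≡ D≈A w v)))

  potential-represented : ∀ Δ k → potential Δ D k ≡ tabulate (λ l → potBelow n A k (toℕ l))
  potential-represented Δ k = tabulate-cong (λ l → sumF≗sumBelow (entry (toℕ l)))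
    where
    entry : ∀ l v → b2n ((toℕ v <ᵇ k) ∧ (suc l ≤ᵇ nbAfter D k v)) ≡ b2n (suc l ≤ᵇ crossing n A k (toℕ v))
    entry l v rewrite nbAfter-represented k v with toℕ v <ᵇ k
    ... | true  = refl
    ... | false = refl

adj : ∀ {n} → Dag n → Adj
adj {n} D x y with x <? n | y <? n
... | yes x<n | yes y<n = arc D (fromℕ< x<n) (fromℕ< y<n)
... | _       | _       = false

adj-represents : ∀ {n} (D : Dag n) → Represents D (adj D)
adj-represents {n} D = represents arc≡adj
  where
  arc≡adj : ∀ a b → arc D a b ≡ adj D (toℕ a) (toℕ b)
  arc≡adj a b with toℕ a <? n | toℕ b <? n
  ... | yes a<n | yes b<n = sym (cong₂ (arc D) (fromℕ<-toℕ a a<n) (fromℕ<-toℕ b b<n))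
  ... | no  a≮n | _       = contradiction (toℕ<n a) a≮n
  ... | yes _   | no  b≮n = contradiction (toℕ<n b) b≮n

adj-forward : ∀ {n} (D : Dag n) → Forward (adj D)
adj-forward {n} D x y arc≡true with x <? n | y <? n
... | yes x<n | yes y<n = subst₂ _<_ (toℕ-fromℕ< x<n) (toℕ-fromℕ< y<n) (forward D _ _ arc≡true)

fromAdj : ∀ m (A : Adj) → Forward A → Dag m
fromAdj m A fwd = record { arc = λ a b → A (toℕ a) (toℕ b) ; forward = λ a b → fwd (toℕ a) (toℕ b) }

fromAdj-represents : ∀ {m A} (fwd : Forward A) → Represents (fromAdj m A fwd) A
fromAdj-represents fwd = represents λ _ _ → refl

extend : ∀ {j} → Permutation′ j → ℕ → ℕ
extend {j} π x with x <? j
... | yes x<j = toℕ (π ⟨$⟩ʳ fromℕ< x<j)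
... | no  _   = x

module _ {j} (π : Permutation′ j) where

  extend-fromℕ< : ∀ {x} (x<j : x < j) → extend π x ≡ toℕ (π ⟨$⟩ʳ fromℕ< x<j)
  extend-fromℕ< {x} x<j with x <? j
  ... | yes _   = refl
  ... | no  x≮j = contradiction x<j x≮j

  extend-< : ∀ {x} → x < j → extend π x < j
  extend-< x<j = subst (_< j) (sym (extend-fromℕ< x<j)) (toℕ<n _)

  sumBelow-extend : ∀ g → sumBelow j (g ∘ extend π) ≡ sumBelow j g
  sumBelow-extend g = begin
    sumBelow j (g ∘ extend π)         ≡⟨ sym (sumF≗sumBelow (λ u → cong g (extend-toℕ u))) ⟩
    sumF (λ u → g (toℕ (π ⟨$⟩ʳ u)))   ≡⟨ sym (sumF-permute (g ∘ toℕ) π) ⟩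
    sumF {j} (g ∘ toℕ)                ≡⟨ sumF≗sumBelow {j} {g = g} (λ _ → refl) ⟩
    sumBelow j g                      ∎
    where
    open ≡-Reasoning
    extend-toℕ : ∀ u → toℕ (π ⟨$⟩ʳ u) ≡ extend π (toℕ u)
    extend-toℕ u = sym (trans (extend-fromℕ< (toℕ<n u)) (cong (λ w → toℕ (π ⟨$⟩ʳ w)) (fromℕ<-toℕ u _)))

shift-head : ∀ {i j x} → x < i → shift i j x ≡ x
shift-head x<i rewrite <ᵇ-true x<i = refl

+-∸-offset : ∀ {i j} → i ≤ j → ∀ t → i + t + (j ∸ i) ≡ j + t
+-∸-offset {i} {j} i≤j t = begin
  i + t + (j ∸ i)   ≡⟨ +-comm (i + t) (j ∸ i) ⟩
  j ∸ i + (i + t)   ≡⟨ sym (+-assoc (j ∸ i) i t) ⟩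
  j ∸ i + i + t     ≡⟨ cong (_+ t) (m∸n+n≡m i≤j) ⟩
  j + t             ∎
  where open ≡-Reasoning

shift-tail : ∀ {i j} → i ≤ j → ∀ t → shift i j (i + t) ≡ j + t
shift-tail {i} i≤j t rewrite <ᵇ-false (m≤m+n i t) = +-∸-offset i≤j t

module Splice {n : ℕ} {A : Adj} (fwd : Forward A) {i j : ℕ} (i≤j : i ≤ j) (j≤n : j ≤ n)
              (π : Permutation′ j) (matching : ∀ u → crossing n A j (toℕ (π ⟨$⟩ʳ u)) ≡ crossing n A i (toℕ u))
              where

  open ≡-Reasoning
  open Cuts {n} {A}

  P : ℕ → ℕ
  P = extend π

  P-< : ∀ {x} → x < j → P x < j
  P-< = extend-< π

  P-matches : ∀ {x} → x < j → crossing n A j (P x) ≡ crossing n A i x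
  P-matches {x} x<j = begin
    crossing n A j (P x)                           ≡⟨ cong (crossing n A j) (extend-fromℕ< π x<j) ⟩
    crossing n A j (toℕ (π ⟨$⟩ʳ fromℕ< x<j))       ≡⟨ matching (fromℕ< x<j) ⟩
    crossing n A i (toℕ (fromℕ< x<j))              ≡⟨ cong (crossing n A i) (toℕ-fromℕ< x<j) ⟩
    crossing n A i x                               ∎

  P-head : ∀ {x} → x < i → nbFrom n A j (P x) ≡ nbFrom n A i x
  P-head {x} x<i = begin
    nbFrom n A j (P x)     ≡⟨ sym (crossing-< (P-< (<-≤-trans x<i i≤j))) ⟩
    crossing n A j (P x)   ≡⟨ P-matches (<-≤-trans x<i i≤j) ⟩
    crossing n A i x       ≡⟨ crossing-< x<i ⟩
    nbFrom n A i x         ∎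

  P-gap : ∀ {x} → i ≤ x → x < j → nbFrom n A j (P x) ≡ 0
  P-gap {x} i≤x x<j = begin
    nbFrom n A j (P x)     ≡⟨ sym (crossing-< (P-< x<j)) ⟩
    crossing n A j (P x)   ≡⟨ P-matches x<j ⟩
    crossing n A i x       ≡⟨ crossing-≥ i≤x ⟩
    0                      ∎

  sumBelow-head : ∀ G → (∀ z → nbFrom n A j z ≡ 0 → G z ≡ 0) → sumBelow i (G ∘ P) ≡ sumBelow j G
  sumBelow-head G G-vanishes = begin
    sumBelow i (G ∘ P)   ≡⟨ sumBelow-trailing-zeros i≤j (λ t i+t<j → G-vanishes _ (P-gap (m≤m+n i t) i+t<j)) ⟨
    sumBelow j (G ∘ P)   ≡⟨ sumBelow-extend π G ⟩
    sumBelow j G         ∎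

  m : ℕ
  m = i + (n ∸ j)

  splice : ∀ g h → sumBelow i g ≡ sumBelow j h → (∀ t → t < n ∸ j → g (i + t) ≡ h (j + t))
    → sumBelow m g ≡ sumBelow n h
  splice g h = sumBelow-splice {i} {j} {n} g h j≤n

  A′ : Adj
  A′ x y = if x <ᵇ i then (if y <ᵇ i then A x y else A (P x) (shift i j y))
           else (if y <ᵇ i then false else A (shift i j x) (shift i j y))

  A′-head-head : ∀ {x y} → x < i → y < i → A′ x y ≡ A x y
  A′-head-head x<i y<i rewrite <ᵇ-true x<i | <ᵇ-true y<i = refl

  A′-head-tail : ∀ {x} t → x < i → A′ x (i + t) ≡ A (P x) (j + t)
  A′-head-tail t x<i rewrite <ᵇ-true x<i | <ᵇ-false (m≤m+n i t) = cong (A _) (+-∸-offset i≤j t)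

  A′-tail-head : ∀ t {y} → y < i → A′ (i + t) y ≡ false
  A′-tail-head t y<i rewrite <ᵇ-false (m≤m+n i t) | <ᵇ-true y<i = refl

  A′-tail-tail : ∀ t s → A′ (i + t) (i + s) ≡ A (j + t) (j + s)
  A′-tail-tail t s rewrite <ᵇ-false (m≤m+n i t) | <ᵇ-false (m≤m+n i s) = cong₂ A (+-∸-offset i≤j t) (+-∸-offset i≤j s)

  A′-forward : Forward A′
  A′-forward x y A′xy with x <? i | y <? i
  ... | yes x<i | yes y<i = fwd x y (trans (sym (A′-head-head x<i y<i)) A′xy)
  ... | yes x<i | no  y≮i = <-≤-trans x<i (≮⇒≥ y≮i)
  ... | no  x≮i | yes y<i with (t , refl) ← m≤n⇒∃[o]m+o≡n (≮⇒≥ x≮i) =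
    contradiction (trans (sym (A′-tail-head t y<i)) A′xy) λ ()
  ... | no  x≮i | no  y≮i
    with (t , refl) ← m≤n⇒∃[o]m+o≡n (≮⇒≥ x≮i) | (s , refl) ← m≤n⇒∃[o]m+o≡n (≮⇒≥ y≮i) =
    +-monoʳ-< i (+-cancelˡ-< j t s (fwd (j + t) (j + s) (trans (sym (A′-tail-tail t s)) A′xy)))

  in-head : ∀ {x} → x < i → inBelow m A′ x ≡ inBelow n A x
  in-head {x} x<i = splice (λ y → b2n (A′ y x)) (λ y → b2n (A y x)) heads tails
    where
    heads : sumBelow i (λ y → b2n (A′ y x)) ≡ sumBelow j (λ y → b2n (A y x))
    heads = begin
      sumBelow i (λ y → b2n (A′ y x))   ≡⟨ sumBelow-cong i (λ y y<i → cong b2n (A′-head-head y<i x<i)) ⟩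
      sumBelow i (λ y → b2n (A y x))
        ≡⟨ sumBelow-trailing-zeros i≤j (λ t _ → cong b2n (forward-false fwd (m≤n⇒m≤n+o t (<⇒≤ x<i)))) ⟨
      sumBelow j (λ y → b2n (A y x))    ∎
    tails : ∀ t → t < n ∸ j → b2n (A′ (i + t) x) ≡ b2n (A (j + t) x)
    tails t _ = cong b2n (trans (A′-tail-head t x<i)
      (sym (forward-false fwd (m≤n⇒m≤n+o t (<⇒≤ (<-≤-trans x<i i≤j))))))

  out-head : ∀ {x} → x < i → outBelow m A′ x ≡ outBelow n A x
  out-head {x} x<i = begin
    outBelow m A′ x
      ≡⟨ sumBelow-+ i (n ∸ j) _ ⟩
    sumBelow i (λ y → b2n (A′ x y)) + sumBelow (n ∸ j) (λ t → b2n (A′ x (i + t)))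
      ≡⟨ cong₂ _+_ (sumBelow-cong i (λ y y<i → cong b2n (A′-head-head x<i y<i)))
                   (sumBelow-cong (n ∸ j) (λ t _ → cong b2n (A′-head-tail t x<i))) ⟩
    sumBelow i (λ y → b2n (A x y)) + sumBelow (n ∸ j) (λ t → b2n (A (P x) (j + t)))
      ≡⟨ cong (_ +_) (sym (nbFrom-tail fwd (P-< (<-≤-trans x<i i≤j)) j≤n)) ⟩
    sumBelow i (λ y → b2n (A x y)) + nbFrom n A j (P x)
      ≡⟨ cong (_ +_) (P-head x<i) ⟩
    sumBelow i (λ y → b2n (A x y)) + nbFrom n A i x
      ≡⟨ sym (outBelow-split fwd x<i (≤-trans i≤j j≤n)) ⟩
    outBelow n A x
      ∎

  in-tail : ∀ t → t < n ∸ j → inBelow m A′ (i + t) ≡ inBelow n A (j + t)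
  in-tail t t<n∸j =
    splice (λ y → b2n (A′ y (i + t))) (λ y → b2n (A y (j + t))) heads (λ s _ → cong b2n (A′-tail-tail s t))
    where
    arc-vanishes : ∀ z → nbFrom n A j z ≡ 0 → b2n (A z (j + t)) ≡ 0
    arc-vanishes z nb≡0 = n≤0⇒n≡0 (subst (_ ≤_) nb≡0 (arc≤nbFrom z (m≤m+n j t) (+-<-∸ j≤n t<n∸j)))
    heads : sumBelow i (λ y → b2n (A′ y (i + t))) ≡ sumBelow j (λ z → b2n (A z (j + t)))
    heads = begin
      sumBelow i (λ y → b2n (A′ y (i + t)))      ≡⟨ sumBelow-cong i (λ y y<i → cong b2n (A′-head-tail t y<i)) ⟩
      sumBelow i (λ y → b2n (A (P y) (j + t)))   ≡⟨ sumBelow-head (λ z → b2n (A z (j + t))) arc-vanishes ⟩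
      sumBelow j (λ z → b2n (A z (j + t)))       ∎

  out-tail : ∀ t → outBelow m A′ (i + t) ≡ outBelow n A (j + t)
  out-tail t =
    splice (λ y → b2n (A′ (i + t) y)) (λ y → b2n (A (j + t) y)) heads (λ s _ → cong b2n (A′-tail-tail t s))
    where
    heads : sumBelow i (λ y → b2n (A′ (i + t) y)) ≡ sumBelow j (λ y → b2n (A (j + t) y))
    heads = trans (sumBelow-zero i (λ y y<i → cong b2n (A′-tail-head t y<i)))
                  (sym (sumBelow-zero j (λ y y<j → cong b2n (forward-false fwd (m≤n⇒m≤n+o t (<⇒≤ y<j))))))

  DegreesAgree : ℕ → ℕ → Set
  DegreesAgree x y = inBelow m A′ x ≡ inBelow n A y × outBelow m A′ x ≡ outBelow n A y

  degrees : ∀ {x} → x < m → DegreesAgree x (shift i j x)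
  degrees {x} x<m with x <? i
  ... | yes x<i = subst (DegreesAgree x) (sym (shift-head x<i)) (in-head x<i , out-head x<i)
  ... | no  x≮i with (t , refl) ← m≤n⇒∃[o]m+o≡n (≮⇒≥ x≮i) =
    subst (DegreesAgree (i + t)) (sym (shift-tail i≤j t)) (in-tail t (+-cancelˡ-< i t (n ∸ j) x<m) , out-tail t)

  nbFrom-splice : ∀ l {x y} → (∀ s → s < n ∸ j → linked A′ x (i + s) ≡ linked A y (j + s))
    → nbFrom m A′ (i + l) x ≡ nbFrom n A (j + l) y
  nbFrom-splice l {x} {y} same =
    splice (λ z → b2n ((i + l ≤ᵇ z) ∧ linked A′ x z)) (λ z → b2n ((j + l ≤ᵇ z) ∧ linked A y z))
    (trans (sumBelow-before-cut (linked A′ x) (m≤m+n i l)) (sym (sumBelow-before-cut (linked A y) (m≤m+n j l))))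
    (λ s s<n∸j → cong b2n (cong₂ _∧_ (trans (+-cancelˡ-≤ᵇ i l s) (sym (+-cancelˡ-≤ᵇ j l s))) (same s s<n∸j)))

  nbFrom-head : ∀ l {x} → x < i → nbFrom m A′ (i + l) x ≡ nbFrom n A (j + l) (P x)
  nbFrom-head l {x} x<i = nbFrom-splice l (λ s _ → cong₂ _∨_ (A′-head-tail s x<i)
    (trans (A′-tail-head s x<i) (sym (forward-false fwd (m≤n⇒m≤n+o s (<⇒≤ (P-< (<-≤-trans x<i i≤j))))))))

  crossing-tail : ∀ l t → crossing m A′ (i + l) (i + t) ≡ crossing n A (j + l) (j + t)
  crossing-tail l t rewrite +-cancelˡ-<ᵇ i t l | +-cancelˡ-<ᵇ j t l =
    cong (λ b → if t <ᵇ l then b else 0) (nbFrom-splice l (λ s _ → cong₂ _∨_ (A′-tail-tail t s) (A′-tail-tail s t)))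

  potBelow-tail : ∀ l c → potBelow m A′ (i + l) c ≡ potBelow n A (j + l) c
  potBelow-tail l c = splice (λ x → b2n (suc c ≤ᵇ crossing m A′ (i + l) x)) G heads
    (λ t _ → cong (λ a → b2n (suc c ≤ᵇ a)) (crossing-tail l t))
    where
    G : ℕ → ℕ
    G z = b2n (suc c ≤ᵇ crossing n A (j + l) z)
    G-vanishes : ∀ z → nbFrom n A j z ≡ 0 → G z ≡ 0
    G-vanishes z nb≡0 = cong (λ a → b2n (suc c ≤ᵇ a)) (n≤0⇒n≡0 (≤-trans (crossing≤nbFrom (j + l) z)
      (subst (nbFrom n A (j + l) z ≤_) nb≡0 (nbFrom-anti z (m≤m+n j l)))))
    crossing-head : ∀ {x} → x < i → crossing m A′ (i + l) x ≡ crossing n A (j + l) (P x)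
    crossing-head {x} x<i = begin
      crossing m A′ (i + l) x       ≡⟨ Cuts.crossing-< {m} {A′} (m≤n⇒m≤n+o l x<i) ⟩
      nbFrom m A′ (i + l) x         ≡⟨ nbFrom-head l x<i ⟩
      nbFrom n A (j + l) (P x)      ≡⟨ sym (crossing-< (m≤n⇒m≤n+o l (P-< (<-≤-trans x<i i≤j)))) ⟩
      crossing n A (j + l) (P x)    ∎
    heads : sumBelow i (λ x → b2n (suc c ≤ᵇ crossing m A′ (i + l) x)) ≡ sumBelow j G
    heads = begin
      sumBelow i (λ x → b2n (suc c ≤ᵇ crossing m A′ (i + l) x))
        ≡⟨ sumBelow-cong i (λ x x<i → cong (λ a → b2n (suc c ≤ᵇ a)) (crossing-head x<i)) ⟩
      sumBelow i (G ∘ P)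
        ≡⟨ sumBelow-head G G-vanishes ⟩
      sumBelow j G
        ∎

module _ {Δ n : ℕ} (D : Dag n) (bounded : ∀ v → indeg D v ≤ Δ × outdeg D v ≤ Δ) where

  open Cuts {n} {adj D}

  crossing≤Δ : ∀ k {x} → x < n → crossing n (adj D) k x ≤ Δ
  crossing≤Δ k {x} x<n = begin
    crossing n (adj D) k x                 ≤⟨ crossing≤outBelow (adj-forward D) k x ⟩
    outBelow n (adj D) x                   ≡⟨ cong (outBelow n (adj D)) (toℕ-fromℕ< x<n) ⟨
    outBelow n (adj D) (toℕ (fromℕ< x<n))  ≡⟨ outdeg-represented (adj-represents D) (fromℕ< x<n) ⟨
    outdeg D (fromℕ< x<n)                  ≤⟨ proj₂ (bounded (fromℕ< x<n)) ⟩
    Δ                                      ∎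
    where open ≤-Reasoning

  potential-entry : ∀ k (e : Fin Δ) → lookup (potential Δ D k) e ≡ potBelow n (adj D) k (toℕ e)
  potential-entry k e = trans (cong (λ p → lookup p e) (potential-represented (adj-represents D) Δ k)) (lookup∘tabulate _ e)

  equal-potentials⇒matching : ∀ {i j} → i ≤ j → j ≤ n → potential Δ D i ≡ potential Δ D j
    → Σ (Permutation′ j) λ π → ∀ u → crossing n (adj D) j (toℕ (π ⟨$⟩ʳ u)) ≡ crossing n (adj D) i (toℕ u)
  equal-potentials⇒matching {i} {j} i≤j j≤n p-equal = equal-atLeast⇒permutation (cut i) (cut j) same-counts
    where
    open ≡-Reasoning
    cut : ℕ → Fin j → ℕ
    cut k u = crossing n (adj D) k (toℕ u)
    entries-equal : ∀ {l} → l < Δ → potBelow n (adj D) i l ≡ potBelow n (adj D) j l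
    entries-equal l<Δ = subst (λ l → potBelow n (adj D) i l ≡ potBelow n (adj D) j l) (toℕ-fromℕ< l<Δ)
      (trans (sym (potential-entry i e)) (trans (cong (λ p → lookup p e) p-equal) (potential-entry j e)))
      where e = fromℕ< l<Δ
    same-counts : ∀ l → atLeast (cut i) l ≡ atLeast (cut j) l
    same-counts zero = refl
    same-counts (suc l) with l <? Δ
    ... | yes l<Δ = begin
      atLeast (cut i) (suc l)       ≡⟨ atLeast-crossing l i≤j j≤n ⟩
      potBelow n (adj D) i l        ≡⟨ entries-equal l<Δ ⟩
      potBelow n (adj D) j l        ≡⟨ atLeast-crossing l ≤-refl j≤n ⟨
      atLeast (cut j) (suc l)       ∎
    ... | no  l≮Δ = trans (atLeast-beyond (cut i) (bound i)) (sym (atLeast-beyond (cut j) (bound j)))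
      where
      bound : ∀ k u → cut k u ≤ l
      bound k u = ≤-trans (crossing≤Δ k (<-≤-trans (toℕ<n u) j≤n)) (≮⇒≥ l≮Δ)

lemma5 : (Δ : ℕ) → 1 ≤ Δ → (n : ℕ) → (D : Dag n)
    → (∀ v → indeg D v ≤ Δ × outdeg D v ≤ Δ)
    → (i j : ℕ) → 1 ≤ i → i < j → j ≤ n
    → potential Δ D i ≡ potential Δ D j
    → Σ (Dag (i + (n ∸ j))) λ D'
      → (∀ (k : Fin (i + (n ∸ j))) (v : Fin n) → toℕ v ≡ shift i j (toℕ k)
           → indeg D' k ≡ indeg D v × outdeg D' k ≡ outdeg D v)
      × (∀ (l : ℕ) → 1 ≤ l → l ≤ n ∸ j
           → potential Δ D' (i + l) ≡ potential Δ D (j + l))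
lemma5 Δ _ n D bounded i j _ i<j j≤n p-equal
  with π , matching ← equal-potentials⇒matching D bounded (<⇒≤ i<j) j≤n p-equal =
  D′ , degrees-preserved , potentials-preserved
  where
  open Splice (adj-forward D) (<⇒≤ i<j) j≤n π matching
  open ≡-Reasoning

  D′ : Dag m
  D′ = fromAdj m A′ A′-forward

  D′≈A′ : Represents D′ A′
  D′≈A′ = fromAdj-represents A′-forward

  degrees-preserved : ∀ k v → toℕ v ≡ shift i j (toℕ k) → indeg D′ k ≡ indeg D v × outdeg D′ k ≡ outdeg D v
  degrees-preserved k v v≡k′ with in-agrees , out-agrees ← degrees (toℕ<n k) =
    trans (indeg-represented D′≈A′ k)
      (trans in-agrees (trans (cong (inBelow n (adj D)) (sym v≡k′)) (sym (indeg-represented (adj-represents D) v)))) ,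
    trans (outdeg-represented D′≈A′ k)
      (trans out-agrees (trans (cong (outBelow n (adj D)) (sym v≡k′)) (sym (outdeg-represented (adj-represents D) v))))

  potentials-preserved : ∀ l → 1 ≤ l → l ≤ n ∸ j → potential Δ D′ (i + l) ≡ potential Δ D (j + l)
  potentials-preserved l _ _ = begin
    potential Δ D′ (i + l)                                 ≡⟨ potential-represented D′≈A′ Δ (i + l) ⟩
    tabulate (λ e → potBelow m A′ (i + l) (toℕ e))         ≡⟨ tabulate-cong (λ e → potBelow-tail l (toℕ e)) ⟩
    tabulate (λ e → potBelow n (adj D) (j + l) (toℕ e))    ≡⟨ potential-represented (adj-represents D) Δ (j + l) ⟨
    potential Δ D (j + l)                                  ∎
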